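{- Let $G$ be a $(C_3,C_5,C_6)$-free graph and $R\in\mathsf{MinRed}(G)$. Then $R$ contains at most $3$ redundant vertices, i.e., $|\mathsf{red}(R)|\leq 3$.
   Context: Graphs are finite, simple, undirected; $N[v]$ is the closed neighborhood. For $I\subseteq V(G)$ and $v\in I$, $\mathsf{priv}(v,I)=\{z\in N[v]:N[z]\cap I=\{v\}\}$. $I$ is irredundant if every element has nonempty $\mathsf{priv}$, redundant otherwise. $\mathsf{MinRed}(G)$ is the family of inclusion-wise minimal redundant sets; for redundant $R$, $\mathsf{red}(R)=\{v\in R:\mathsf{priv}(v,R)=\emptyset\}$ is its set of redundant vertices. $(C_3,C_5,C_6)$-free means no induced cycle of length 3, 5 or 6. -}

module Defs where

open import Data.Nat using (ℕ; suc; NonZero; _%_)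
open import Data.Bool using (Bool; true; false; _∨_; _∧_)
open import Data.Bool.Properties using () renaming (_≟_ to _≟ᵇ_)
open import Data.Fin using (Fin; toℕ; _≟_)
open import Data.Fin.Subset using (Subset; _∈_; _∩_; ⁅_⁆; _⊂_; Nonempty; Empty)
open import Data.Fin.Subset.Properties using (_∈?_; nonempty?)
open import Data.Vec using (tabulate)
open import Data.Vec.Properties using (≡-dec)
open import Data.Product using (Σ; _×_)
open import Data.Sum using (_⊎_)
open import Relation.Nullary using (¬_; does)
open import Relation.Binary.PropositionalEquality using (_≡_)
open import Function.Definitions using (Injective)

record Graph (n : ℕ) : Set where
  field
    adj     : Fin n → Fin n → Bool
    sym     : ∀ u v → adj u v ≡ adj v u
    irrefl  : ∀ v → adj v v ≡ false
open Graph public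

module _ {n : ℕ} (G : Graph n) where

  N[_] : Fin n → Subset n
  N[ v ] = tabulate (λ z → does (z ≟ v) ∨ adj G v z)

  priv : Fin n → Subset n → Subset n
  priv v I = tabulate (λ z → does (z ∈? N[ v ]) ∧ does (≡-dec _≟ᵇ_ (N[ z ] ∩ I) ⁅ v ⁆))

  Irredundant : Subset n → Set
  Irredundant I = ∀ v → v ∈ I → Nonempty (priv v I)

  Redundant : Subset n → Set
  Redundant I = ¬ Irredundant I

  MinRed : Subset n → Set
  MinRed R = Redundant R × (∀ S → S ⊂ R → ¬ Redundant S)

  red : Subset n → Subset n
  red R = tabulate (λ v → does (v ∈? R) ∧ Data.Bool.not (does (nonempty? (priv v R))))

  CycAdj : (k : ℕ) → .{{NonZero k}} → Fin k → Fin k → Set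
  CycAdj k i j = (suc (toℕ i) % k ≡ toℕ j) ⊎ (suc (toℕ j) % k ≡ toℕ i)

  HasInducedCycle : (k : ℕ) → .{{NonZero k}} → Set
  HasInducedCycle k = Σ (Fin k → Fin n) λ f →
    Injective _≡_ _≡_ f ×
    (∀ i j → (adj G (f i) (f j) ≡ true → CycAdj k i j) × (CycAdj k i j → adj G (f i) (f j) ≡ true))

  C3C5C6-free : Set
  C3C5C6-free = ¬ HasInducedCycle 3 × ¬ HasInducedCycle 5 × ¬ HasInducedCycle 6

-- A redundant vertex v of a minimal redundant set R has, for every other u ∈ R, a
-- "bridge": a private neighbour z of v with respect to R - u, which then sees exactly
-- u and v in R.  Without triangles the bridge of an edge uv is u or v itself, so one
-- end of every edge between redundant vertices has no other neighbour in R.  Bridges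
-- of non-adjacent pairs are common neighbours, and they assemble into an induced C₅
-- when a redundant vertex misses both ends of an edge of R, and into an induced C₆ on
-- three pairwise non-adjacent redundant vertices.  These three facts leave no room for
-- four redundant vertices.

module Submission where

open import Defs
open import Data.Nat using (ℕ; _≤_)
open import Data.Fin.Subset using (Subset; ∣_∣)

open import Data.Nat as ℕ using (NonZero; _+_; _%_; s≤s)
import Data.Nat.Properties as ℕ
open import Data.Bool using (Bool; true; false; T)
open import Data.Bool.Properties using (T-≡; T-∧; T-∨; T-not-≡; ¬-not; ∨-comm)
  renaming (_≟_ to _≟ᵇ_)
open import Data.Fin using (Fin; Fin′; zero; suc; toℕ; inject; fromℕ<; _<_; _≟_)
open import Data.Fin.Patterns using (0F; 1F; 2F; 3F; 4F; 5F)
open import Data.Fin.Properties using (all?; <-cmp; toℕ-injective; toℕ-inject; toℕ-fromℕ<)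
open import Data.Fin.Subset using (_∈_; _∉_; _⊆_; _⊂_; _∩_; _-_; ⁅_⁆; Empty; inside; outside)
open import Data.Fin.Subset.Properties
  using ( _∈?_; nonempty?; x∈p∩q⁺; x∈p∩q⁻; x∈p∧x≢y⇒x∈p-y; p─q⊆p; ⊆-antisym; x∈⁅y⁆⇒x≡y
        ; x∈p⇒p-x⊂p; p─⊥≡p; Empty-unique; ∣⊥∣≡0)
open import Data.Vec using ([]; _∷_; lookup; tabulate; there)
open import Data.Vec.Properties using (lookup∘tabulate; []=⇒lookup; lookup⇒[]=; ≡-dec)
open import Data.Product using (∃; _×_; _,_; proj₁)
open import Data.Sum using (_⊎_; inj₁; inj₂; [_,_])
open import Data.Empty using (⊥; ⊥-elim)
open import Function using (id; _∘_; _⇔_; Equivalence; mk⇔)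
open import Function.Definitions using (Injective)
open import Relation.Binary using (tri<; tri≈; tri>)
open import Relation.Nullary using (¬_; Dec; yes; no; does)
open import Relation.Nullary.Decidable using (from-yes; decidable-stable; _⊎-dec_; _×-dec_; _→-dec_)
open import Relation.Binary.PropositionalEquality as ≡
  using (_≡_; _≢_; refl; trans; cong; subst; ≢-sym)

∣p∣≤1+∣p-x∣ : ∀ {n} (p : Subset n) x → ∣ p ∣ ≤ 1 + ∣ p - x ∣
∣p∣≤1+∣p-x∣ (inside ∷ p) zero = ℕ.≤-reflexive (cong (ℕ.suc ∘ ∣_∣) (≡.sym (p─⊥≡p p)))
∣p∣≤1+∣p-x∣ (outside ∷ p) zero = ℕ.m≤n⇒m≤1+n (ℕ.≤-reflexive (cong ∣_∣ (≡.sym (p─⊥≡p p))))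
∣p∣≤1+∣p-x∣ (inside ∷ p) (suc x) = s≤s (∣p∣≤1+∣p-x∣ p x)
∣p∣≤1+∣p-x∣ (outside ∷ p) (suc x) = ∣p∣≤1+∣p-x∣ p x

x∈p-y⇒x≢y : ∀ {n} {p : Subset n} {x y} → x ∈ p - y → x ≢ y
x∈p-y⇒x≢y {p = _ ∷ p} {zero} {zero} ()
x∈p-y⇒x≢y {p = _ ∷ p} {suc x} {suc y} (there x∈p-y) refl = x∈p-y⇒x≢y x∈p-y refl
x∈p-y⇒x≢y {x = zero} {suc y} _ ()
x∈p-y⇒x≢y {x = suc x} {zero} _ ()

x∈p-y⁻ : ∀ {n} {p : Subset n} {x y} → x ∈ p - y → x ∈ p × x ≢ y
x∈p-y⁻ {p = p} {y = y} x∈p-y = p─q⊆p p ⁅ y ⁆ x∈p-y , x∈p-y⇒x≢y x∈p-y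

x∉p⇒p∩[q-x]≡p∩q : ∀ {n} {p q : Subset n} {x} → x ∉ p → p ∩ (q - x) ≡ p ∩ q
x∉p⇒p∩[q-x]≡p∩q {p = p} {q} {x} x∉p = ⊆-antisym forward backward
  where
  forward : p ∩ (q - x) ⊆ p ∩ q
  forward y∈ with y∈p , y∈q-x ← x∈p∩q⁻ p (q - x) y∈ = x∈p∩q⁺ (y∈p , proj₁ (x∈p-y⁻ y∈q-x))
  backward : p ∩ q ⊆ p ∩ (q - x)
  backward y∈ with y∈p , y∈q ← x∈p∩q⁻ p q y∈ =
    x∈p∩q⁺ (y∈p , x∈p∧x≢y⇒x∈p-y y∈q λ { refl → x∉p y∈p })

element-of-large : ∀ {n m} (p : Subset n) → 1 + m ≤ ∣ p ∣ → ∃ λ x → x ∈ p × m ≤ ∣ p - x ∣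
element-of-large {n} p 1+m≤∣p∣ with nonempty? p
... | yes (x , x∈p) = x , x∈p , ℕ.≤-pred (ℕ.≤-trans 1+m≤∣p∣ (∣p∣≤1+∣p-x∣ p x))
... | no ∅ with () ← subst (_ ≤_) (trans (cong ∣_∣ (Empty-unique ∅)) (∣⊥∣≡0 n)) 1+m≤∣p∣

no-four-distinct⇒∣p∣≤3 : ∀ {n} (p : Subset n) →
  (∀ {a b c d} → a ∈ p → b ∈ p → c ∈ p → d ∈ p →
     a ≢ b → a ≢ c → a ≢ d → b ≢ c → b ≢ d → c ≢ d → ⊥) →
  ∣ p ∣ ≤ 3
no-four-distinct⇒∣p∣≤3 p no-four with ∣ p ∣ ℕ.≤? 3
... | yes ∣p∣≤3 = ∣p∣≤3
... | no ∣p∣≰3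
  with a , a∈p , 3≤∣p-a∣ ← element-of-large p (ℕ.≰⇒> ∣p∣≰3)
  with b , b∈p-a , 2≤∣p-a-b∣ ← element-of-large (p - a) 3≤∣p-a∣
  with c , c∈p-a-b , 1≤∣p-a-b-c∣ ← element-of-large (p - a - b) 2≤∣p-a-b∣
  with d , d∈p-a-b-c , _ ← element-of-large (p - a - b - c) 1≤∣p-a-b-c∣ =
  let b∈p , b≢a = x∈p-y⁻ b∈p-a
      c∈p-a , c≢b = x∈p-y⁻ c∈p-a-b
      c∈p , c≢a = x∈p-y⁻ c∈p-a
      d∈p-a-b , d≢c = x∈p-y⁻ d∈p-a-b-c
      d∈p-a , d≢b = x∈p-y⁻ d∈p-a-b
      d∈p , d≢a = x∈p-y⁻ d∈p-a
  in ⊥-elim (no-four a∈p b∈p c∈p d∈p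
       (≢-sym b≢a) (≢-sym c≢a) (≢-sym d≢a) (≢-sym c≢b) (≢-sym d≢b) (≢-sym d≢c))

T-does⇔ : ∀ {A : Set} (a? : Dec A) → T (does a?) ⇔ A
T-does⇔ (yes a) = mk⇔ (λ _ → a) _
T-does⇔ (no ¬a) = mk⇔ (λ ()) ¬a

∈tabulate⇔T : ∀ {n} {f : Fin n → Bool} {x} → x ∈ tabulate f ⇔ T (f x)
∈tabulate⇔T {f = f} {x} = mk⇔
  (λ x∈ → Equivalence.from T-≡ (trans (≡.sym (lookup∘tabulate f x)) ([]=⇒lookup x∈)))
  (λ Tfx → lookup⇒[]= x _ (trans (lookup∘tabulate f x) (Equivalence.to T-≡ Tfx)))

module GraphNotation {n : ℕ} (G : Graph n) where

  infix 4 _~_ _≁_ _~⁼_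

  _~_ _≁_ _~⁼_ : Fin n → Fin n → Set
  x ~ y = adj G x y ≡ true
  x ≁ y = adj G x y ≡ false
  x ~⁼ y = x ≡ y ⊎ x ~ y

  ~-sym : ∀ {x y} → x ~ y → y ~ x
  ~-sym {x} {y} = trans (Graph.sym G y x)

  ≁-sym : ∀ {x y} → x ≁ y → y ≁ x
  ≁-sym {x} {y} = trans (Graph.sym G y x)

  ~⁼-sym : ∀ {x y} → x ~⁼ y → y ~⁼ x
  ~⁼-sym (inj₁ x≡y) = inj₁ (≡.sym x≡y)
  ~⁼-sym (inj₂ x~y) = inj₂ (~-sym x~y)

  ~⇒≢ : ∀ {x y} → x ~ y → x ≢ y
  ~⇒≢ {x} x~x refl with () ← trans (≡.sym x~x) (irrefl G x)

  ~⇒¬≁ : ∀ {x y} → x ~ y → ¬ x ≁ y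
  ~⇒¬≁ x~y x≁y with () ← trans (≡.sym x~y) x≁y

  ¬~⇒≁ : ∀ {x y} → ¬ x ~ y → x ≁ y
  ¬~⇒≁ = ¬-not

  ~-or-≁ : ∀ x y → x ~ y ⊎ x ≁ y
  ~-or-≁ x y with adj G x y
  ... | true = inj₁ refl
  ... | false = inj₂ refl

  common-~⁼-of-≁ : ∀ {x y z} → x ≁ y → x ≢ y → x ~⁼ z → y ~⁼ z → x ~ z × y ~ z
  common-~⁼-of-≁ _ x≢y (inj₁ refl) (inj₁ refl) = ⊥-elim (x≢y refl)
  common-~⁼-of-≁ x≁y _ (inj₁ refl) (inj₂ y~x) = ⊥-elim (~⇒¬≁ (~-sym y~x) x≁y)
  common-~⁼-of-≁ x≁y _ (inj₂ x~y) (inj₁ refl) = ⊥-elim (~⇒¬≁ x~y x≁y)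
  common-~⁼-of-≁ _ _ (inj₂ x~z) (inj₂ y~z) = x~z , y~z

  ∈N[]⇔ : ∀ {v z} → z ∈ N[_] G v ⇔ z ~⁼ v
  ∈N[]⇔ {v} {z} = mk⇔ from to
    where
    from : z ∈ N[_] G v → z ~⁼ v
    from z∈N[v] with Equivalence.to T-∨ (Equivalence.to ∈tabulate⇔T z∈N[v])
    ... | inj₁ z≡v = inj₁ (Equivalence.to (T-does⇔ (z ≟ v)) z≡v)
    ... | inj₂ v~z = inj₂ (~-sym (Equivalence.to T-≡ v~z))
    to : z ~⁼ v → z ∈ N[_] G v
    to z~⁼v = Equivalence.from ∈tabulate⇔T (Equivalence.from T-∨ (case z~⁼v))
      where
      case : z ~⁼ v → T (does (z ≟ v)) ⊎ T (adj G v z)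
      case (inj₁ z≡v) = inj₁ (Equivalence.from (T-does⇔ (z ≟ v)) z≡v)
      case (inj₂ z~v) = inj₂ (Equivalence.from T-≡ (~-sym z~v))

module Redundancy {n : ℕ} (G : Graph n) where
  open GraphNotation G

  ∈priv⇔ : ∀ {v z I} → z ∈ priv G v I ⇔ (z ~⁼ v × N[_] G z ∩ I ≡ ⁅ v ⁆)
  ∈priv⇔ {v} {z} {I} = mk⇔
    (λ z∈ → let z∈N[v] , N[z]∩I≡v = Equivalence.to T-∧ (Equivalence.to ∈tabulate⇔T z∈)
            in Equivalence.to ∈N[]⇔ (Equivalence.to (T-does⇔ (z ∈? N[_] G v)) z∈N[v])
             , Equivalence.to (T-does⇔ (≡-dec _≟ᵇ_ (N[_] G z ∩ I) ⁅ v ⁆)) N[z]∩I≡v)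
    (λ (z~⁼v , N[z]∩I≡v) → Equivalence.from ∈tabulate⇔T (Equivalence.from T-∧
       ( Equivalence.from (T-does⇔ (z ∈? N[_] G v)) (Equivalence.from ∈N[]⇔ z~⁼v)
       , Equivalence.from (T-does⇔ (≡-dec _≟ᵇ_ (N[_] G z ∩ I) ⁅ v ⁆)) N[z]∩I≡v)))

  ∈red⁻ : ∀ {v R} → v ∈ red G R → v ∈ R × Empty (priv G v R)
  ∈red⁻ {v} {R} v∈ =
    let v∈R , no-priv = Equivalence.to T-∧ (Equivalence.to ∈tabulate⇔T v∈)
    in Equivalence.to (T-does⇔ (v ∈? R)) v∈R
     , λ priv≠∅ → subst T (Equivalence.to T-not-≡ no-priv)
                          (Equivalence.from (T-does⇔ (nonempty? (priv G v R))) priv≠∅)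

  red⊆ : ∀ {v R} → v ∈ red G R → v ∈ R
  red⊆ = proj₁ ∘ ∈red⁻

  irredundant? : ∀ I → Dec (Irredundant G I)
  irredundant? I = all? λ v → (v ∈? I) →-dec nonempty? (priv G v I)

  proper-subset-irredundant : ∀ {R S} → MinRed G R → S ⊂ R → Irredundant G S
  proper-subset-irredundant {S = S} (_ , minimal) S⊂R =
    decidable-stable (irredundant? S) (minimal S S⊂R)

module InducedCycles {n : ℕ} (G : Graph n) where
  open GraphNotation G

  cycAdj? : ∀ k .{{_ : NonZero k}} i j → Dec (CycAdj G k i j)
  cycAdj? k i j = (ℕ.suc (toℕ i) % k ℕ.≟ toℕ j) ⊎-dec (ℕ.suc (toℕ j) % k ℕ.≟ toℕ i)

  cyc : ∀ k .{{_ : NonZero k}} → Fin k → Fin k → Bool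
  cyc k i j = does (cycAdj? k i j)

  cyc-sym : ∀ k .{{_ : NonZero k}} i j → cyc k i j ≡ cyc k j i
  cyc-sym k i j = ∨-comm (does (ℕ.suc (toℕ i) % k ℕ.≟ toℕ j)) _

  LooplessTwinFree : ∀ k .{{_ : NonZero k}} → Set
  LooplessTwinFree k =
    (∀ i → cyc k i i ≡ false) × (∀ i j → (∀ m → cyc k i m ≡ cyc k j m) → i ≡ j)

  looplessTwinFree? : ∀ k .{{_ : NonZero k}} → Dec (LooplessTwinFree k)
  looplessTwinFree? k =
    all? (λ i → cyc k i i ≟ᵇ false) ×-dec
    all? (λ i → all? λ j → all? (λ m → cyc k i m ≟ᵇ cyc k j m) →-dec (i ≟ j))

  -- Pairs below the diagonal suffice: the rest follows by symmetry and irreflexivity.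
  inducedCycle : ∀ k .{{_ : NonZero k}} → LooplessTwinFree k → (f : Fin k → Fin n) →
    (∀ j (i : Fin′ j) → adj G (f j) (f (inject i)) ≡ cyc k j (inject i)) → HasInducedCycle G k
  inducedCycle k (cyc-irrefl , cyc-rows-distinct) f lower =
    f , injective , λ i j → sound i j , complete i j
    where
    lower′ : ∀ {i j} → i < j → adj G (f j) (f i) ≡ cyc k j i
    lower′ {i} {j} i<j =
      subst (λ i → adj G (f j) (f i) ≡ cyc k j i)
        (toℕ-injective (trans (toℕ-inject (fromℕ< i<j)) (toℕ-fromℕ< i<j)))
        (lower j (fromℕ< i<j))
    adjacency : ∀ i j → adj G (f i) (f j) ≡ cyc k i j
    adjacency i j with <-cmp i j
    ... | tri< i<j _ _ = trans (Graph.sym G (f i) (f j)) (trans (lower′ i<j) (cyc-sym k j i))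
    ... | tri≈ _ refl _ = trans (irrefl G (f i)) (≡.sym (cyc-irrefl i))
    ... | tri> _ _ j<i = lower′ j<i
    injective : Injective _≡_ _≡_ f
    injective {i} {j} fi≡fj = cyc-rows-distinct i j λ m →
      trans (≡.sym (adjacency i m)) (trans (cong (λ x → adj G x (f m)) fi≡fj) (adjacency j m))
    sound : ∀ i j → f i ~ f j → CycAdj G k i j
    sound i j fi~fj = Equivalence.to (T-does⇔ (cycAdj? k i j))
      (Equivalence.from T-≡ (trans (≡.sym (adjacency i j)) fi~fj))
    complete : ∀ i j → CycAdj G k i j → f i ~ f j
    complete i j i~j = trans (adjacency i j)
      (Equivalence.to T-≡ (Equivalence.from (T-does⇔ (cycAdj? k i j)) i~j))

  looplessTwinFree3 : LooplessTwinFree 3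
  looplessTwinFree3 = from-yes (looplessTwinFree? 3)

  looplessTwinFree5 : LooplessTwinFree 5
  looplessTwinFree5 = from-yes (looplessTwinFree? 5)

  looplessTwinFree6 : LooplessTwinFree 6
  looplessTwinFree6 = from-yes (looplessTwinFree? 6)

  triangle : ∀ {x y z} → x ~ y → y ~ z → z ~ x → HasInducedCycle G 3
  triangle {x} {y} {z} x~y y~z z~x =
    inducedCycle 3 looplessTwinFree3 (lookup (x ∷ y ∷ z ∷ [])) λ where
      0F ()
      1F 0F → ~-sym x~y
      2F 0F → z~x
      2F 1F → ~-sym y~z

module MinimalRedundantSet {n : ℕ} (G : Graph n) {R : Subset n} (minRed : MinRed G R) where
  open GraphNotation G
  open Redundancy G
  open InducedCycles G

  Bridge : Fin n → Fin n → Fin n → Set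
  Bridge u v z = u ~⁼ z × v ~⁼ z × (∀ {w} → w ∈ R → w ~⁼ z → w ≡ u ⊎ w ≡ v)

  -- By minimality v has a private neighbour z with respect to R - u, but it has none
  -- with respect to R, so u is the only further vertex of R that z sees.
  bridge : ∀ {u v} → v ∈ red G R → u ∈ R → u ≢ v → ∃ (Bridge u v)
  bridge {u} {v} v∈red u∈R u≢v
    with v∈R , v-has-no-priv ← ∈red⁻ v∈red
    with z , z∈priv ← proper-subset-irredundant minRed (x∈p⇒p-x⊂p u∈R) v
                        (x∈p∧x≢y⇒x∈p-y v∈R (≢-sym u≢v))
    with z~⁼v , N[z]∩[R-u]≡v ← Equivalence.to ∈priv⇔ z∈priv
    with u ∈? N[_] G z
  ... | no u∉N[z] = ⊥-elim (v-has-no-priv (z , Equivalence.from ∈priv⇔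
          (z~⁼v , trans (≡.sym (x∉p⇒p∩[q-x]≡p∩q u∉N[z])) N[z]∩[R-u]≡v)))
  ... | yes u∈N[z] = z , Equivalence.to ∈N[]⇔ u∈N[z] , ~⁼-sym z~⁼v , sees-only-u-v
    where
    sees-only-u-v : ∀ {w} → w ∈ R → w ~⁼ z → w ≡ u ⊎ w ≡ v
    sees-only-u-v {w} w∈R w~⁼z with w ≟ u
    ... | yes w≡u = inj₁ w≡u
    ... | no w≢u = inj₂ (x∈⁅y⁆⇒x≡y v (subst (w ∈_) N[z]∩[R-u]≡v
                     (x∈p∩q⁺ (Equivalence.from ∈N[]⇔ w~⁼z , x∈p∧x≢y⇒x∈p-y w∈R w≢u))))

  bridge-≁ : ∀ {u v z w} → Bridge u v z → w ∈ R → w ≢ u → w ≢ v → w ≁ z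
  bridge-≁ (_ , _ , sees-only-u-v) w∈R w≢u w≢v = ¬~⇒≁ λ w~z →
    [ w≢u , w≢v ] (sees-only-u-v w∈R (inj₂ w~z))

  PendantTo : Fin n → Fin n → Set
  PendantTo x y = ∀ {p} → p ∈ R → x ~ p → p ≡ y

  module TriangleFree (no-C3 : ¬ HasInducedCycle G 3) where

    common-neighbours-≁ : ∀ {x y z} → x ~ y → x ~ z → y ≁ z
    common-neighbours-≁ x~y x~z = ¬~⇒≁ λ y~z → no-C3 (triangle x~y y~z (~-sym x~z))

    common-~⁼-of-~ : ∀ {x y z} → x ~ y → x ~⁼ z → y ~⁼ z → z ≡ x ⊎ z ≡ y
    common-~⁼-of-~ _ (inj₁ refl) _ = inj₁ refl
    common-~⁼-of-~ _ (inj₂ _) (inj₁ refl) = inj₂ refl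
    common-~⁼-of-~ x~y (inj₂ x~z) (inj₂ y~z) = ⊥-elim (~⇒¬≁ y~z (common-neighbours-≁ x~y x~z))

    -- A bridge of an edge is one of its ends, and that end sees no further vertex of R.
    redundant-edge-pendant : ∀ {x y} → x ∈ red G R → y ∈ R → x ~ y → PendantTo x y ⊎ PendantTo y x
    redundant-edge-pendant {x} {y} x∈red y∈R x~y
      with z , y~⁼z , x~⁼z , sees-only-y-x ← bridge x∈red y∈R (≢-sym (~⇒≢ x~y))
      with common-~⁼-of-~ x~y x~⁼z y~⁼z
    ... | inj₁ refl = inj₁ λ p∈R x~p →
            [ id , (λ p≡x → ⊥-elim (~⇒≢ x~p (≡.sym p≡x))) ] (sees-only-y-x p∈R (inj₂ (~-sym x~p)))
    ... | inj₂ refl = inj₂ λ p∈R y~p →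
            [ (λ p≡y → ⊥-elim (~⇒≢ y~p (≡.sym p≡y))) , id ] (sees-only-y-x p∈R (inj₂ (~-sym y~p)))

    -- Otherwise x z₁ w z₂ y, with z₁ bridging x, w and z₂ bridging y, w, is an induced C₅.
    redundant-sees-edge : ¬ HasInducedCycle G 5 → ∀ {w x y} → w ∈ red G R → x ∈ R → y ∈ R →
      x ~ y → w ≢ x → w ≢ y → w ~ x ⊎ w ~ y
    redundant-sees-edge no-C5 {w} {x} {y} w∈red x∈R y∈R x~y w≢x w≢y
      with ~-or-≁ w x | ~-or-≁ w y
    ... | inj₁ w~x | _ = inj₁ w~x
    ... | inj₂ _ | inj₁ w~y = inj₂ w~y
    ... | inj₂ w≁x | inj₂ w≁y
      with z₁ , b₁@(x~⁼z₁ , w~⁼z₁ , _) ← bridge w∈red x∈R (≢-sym w≢x)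
      with z₂ , b₂@(y~⁼z₂ , w~⁼z₂ , _) ← bridge w∈red y∈R (≢-sym w≢y)
      with x~z₁ , w~z₁ ← common-~⁼-of-≁ (≁-sym w≁x) (≢-sym w≢x) x~⁼z₁ w~⁼z₁
      with y~z₂ , w~z₂ ← common-~⁼-of-≁ (≁-sym w≁y) (≢-sym w≢y) y~⁼z₂ w~⁼z₂
      = ⊥-elim (no-C5 (inducedCycle 5 looplessTwinFree5 (lookup (x ∷ z₁ ∷ w ∷ z₂ ∷ y ∷ [])) λ where
          0F ()
          1F 0F → ~-sym x~z₁
          2F 0F → w≁x
          2F 1F → w~z₁
          3F 0F → ≁-sym (bridge-≁ b₂ x∈R (~⇒≢ x~y) (≢-sym w≢x))
          3F 1F → common-neighbours-≁ w~z₂ w~z₁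
          3F 2F → ~-sym w~z₂
          4F 0F → ~-sym x~y
          4F 1F → bridge-≁ b₁ y∈R (≢-sym (~⇒≢ x~y)) (≢-sym w≢y)
          4F 2F → ≁-sym w≁y
          4F 3F → y~z₂))

    -- The bridges z₁, z₂, z₃ of the pairs xy, yw, wx close an induced C₆ x z₁ y z₂ w z₃.
    no-independent-redundant-triple : ¬ HasInducedCycle G 6 → ∀ {x y w} →
      x ∈ red G R → y ∈ red G R → w ∈ red G R → x ≁ y → y ≁ w → w ≁ x →
      x ≢ y → y ≢ w → w ≢ x → ⊥
    no-independent-redundant-triple no-C6 {x} {y} {w} x∈red y∈red w∈red x≁y y≁w w≁x x≢y y≢w w≢x
      with z₁ , b₁@(y~⁼z₁ , x~⁼z₁ , _) ← bridge x∈red (red⊆ y∈red) (≢-sym x≢y)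
      with z₂ , b₂@(w~⁼z₂ , y~⁼z₂ , _) ← bridge y∈red (red⊆ w∈red) (≢-sym y≢w)
      with z₃ , b₃@(x~⁼z₃ , w~⁼z₃ , _) ← bridge w∈red (red⊆ x∈red) (≢-sym w≢x)
      with x~z₁ , y~z₁ ← common-~⁼-of-≁ x≁y x≢y x~⁼z₁ y~⁼z₁
      with y~z₂ , w~z₂ ← common-~⁼-of-≁ y≁w y≢w y~⁼z₂ w~⁼z₂
      with w~z₃ , x~z₃ ← common-~⁼-of-≁ w≁x w≢x w~⁼z₃ x~⁼z₃
      = no-C6 (inducedCycle 6 looplessTwinFree6 (lookup (x ∷ z₁ ∷ y ∷ z₂ ∷ w ∷ z₃ ∷ [])) λ where
          0F ()
          1F 0F → ~-sym x~z₁
          2F 0F → ≁-sym x≁y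
          2F 1F → y~z₁
          3F 0F → ≁-sym (bridge-≁ b₂ (red⊆ x∈red) (≢-sym w≢x) x≢y)
          3F 1F → common-neighbours-≁ y~z₂ y~z₁
          3F 2F → ~-sym y~z₂
          4F 0F → w≁x
          4F 1F → bridge-≁ b₁ (red⊆ w∈red) (≢-sym y≢w) w≢x
          4F 2F → ≁-sym y≁w
          4F 3F → w~z₂
          5F 0F → ~-sym x~z₃
          5F 1F → common-neighbours-≁ x~z₃ x~z₁
          5F 2F → ≁-sym (bridge-≁ b₃ (red⊆ y∈red) (≢-sym x≢y) y≢w)
          5F 3F → common-neighbours-≁ w~z₃ w~z₂
          5F 4F → ~-sym w~z₃)

  module C3C5C6Free (no-C3 : ¬ HasInducedCycle G 3) (no-C5 : ¬ HasInducedCycle G 5)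
                    (no-C6 : ¬ HasInducedCycle G 6) where
    open TriangleFree no-C3

    -- If x is pendant to y, the two other vertices both hang on y, which leaves x and
    -- them pairwise non-adjacent.
    pendant-edge-with-two-more : ∀ {x y u w} → PendantTo x y → x ~ y →
      x ∈ red G R → y ∈ R → u ∈ red G R → w ∈ red G R →
      u ≢ x → u ≢ y → w ≢ x → w ≢ y → u ≢ w → ⊥
    pendant-edge-with-two-more {x} {y} x-pendant x~y x∈red y∈R u∈red w∈red u≢x u≢y w≢x w≢y u≢w =
      no-independent-redundant-triple no-C6 x∈red u∈red w∈red
        (x≁ u∈red u≢y) (common-neighbours-≁ (~-sym (~y u∈red u≢x u≢y)) (~-sym (~y w∈red w≢x w≢y)))
        (≁-sym (x≁ w∈red w≢y)) (≢-sym u≢x) u≢w w≢x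
      where
      x≁ : ∀ {v} → v ∈ red G R → v ≢ y → x ≁ v
      x≁ v∈red v≢y = ¬~⇒≁ λ x~v → v≢y (x-pendant (red⊆ v∈red) x~v)
      ~y : ∀ {v} → v ∈ red G R → v ≢ x → v ≢ y → v ~ y
      ~y v∈red v≢x v≢y
        with redundant-sees-edge no-C5 v∈red (red⊆ x∈red) y∈R x~y v≢x v≢y
      ... | inj₁ v~x = ⊥-elim (~⇒¬≁ (~-sym v~x) (x≁ v∈red v≢y))
      ... | inj₂ v~y = v~y

    redundant-edge-with-two-more : ∀ {x y u w} → x ~ y →
      x ∈ red G R → y ∈ red G R → u ∈ red G R → w ∈ red G R →
      u ≢ x → u ≢ y → w ≢ x → w ≢ y → u ≢ w → ⊥
    redundant-edge-with-two-more x~y x∈red y∈red u∈red w∈red u≢x u≢y w≢x w≢y u≢w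
      with redundant-edge-pendant x∈red (red⊆ y∈red) x~y
    ... | inj₁ x-pendant =
      pendant-edge-with-two-more x-pendant x~y x∈red (red⊆ y∈red) u∈red w∈red u≢x u≢y w≢x w≢y u≢w
    ... | inj₂ y-pendant =
      pendant-edge-with-two-more y-pendant (~-sym x~y) y∈red (red⊆ x∈red) u∈red w∈red u≢y u≢x w≢y w≢x u≢w

    no-four-redundant : ∀ {a b c d} → a ∈ red G R → b ∈ red G R → c ∈ red G R → d ∈ red G R →
      a ≢ b → a ≢ c → a ≢ d → b ≢ c → b ≢ d → c ≢ d → ⊥
    no-four-redundant {a} {b} {c} a∈ b∈ c∈ d∈ a≢b a≢c a≢d b≢c b≢d c≢d
      with ~-or-≁ a b
    ... | inj₁ a~b = redundant-edge-with-two-more a~b a∈ b∈ c∈ d∈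
                       (≢-sym a≢c) (≢-sym b≢c) (≢-sym a≢d) (≢-sym b≢d) c≢d
    ... | inj₂ a≁b with ~-or-≁ a c
    ... | inj₁ a~c = redundant-edge-with-two-more a~c a∈ c∈ b∈ d∈
                       (≢-sym a≢b) b≢c (≢-sym a≢d) (≢-sym c≢d) b≢d
    ... | inj₂ a≁c with ~-or-≁ b c
    ... | inj₁ b~c = redundant-edge-with-two-more b~c b∈ c∈ a∈ d∈
                       a≢b a≢c (≢-sym b≢d) (≢-sym c≢d) a≢d
    ... | inj₂ b≁c = no-independent-redundant-triple no-C6 a∈ b∈ c∈
                       a≁b b≁c (≁-sym a≁c) a≢b b≢c (≢-sym a≢c)

corollary22 : (n : ℕ) (G : Graph n) → C3C5C6-free G → (R : Subset n) → MinRed G R →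
    ∣ red G R ∣ ≤ 3
corollary22 n G (no-C3 , no-C5 , no-C6) R minRed =
  no-four-distinct⇒∣p∣≤3 (red G R) no-four-redundant
  where open MinimalRedundantSet G minRed
        open C3C5C6Free no-C3 no-C5 no-C6
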